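{- Let $m\ge 1$ and let $\mathcal I_m$ be the set of greedy $m$-Tamari intervals $[v,w]$ of positive size, with product $[v_1,w_1]*[v_2,w_2]:=[v_1*v_2,\,w_1*w_2]$ (which is again an interval). Then $\mathcal I_m$ is a monoid with unit $[10^m,10^m]$, and it is free over the generators $[v,w]$ where $v$ is one of the paths $D(u_1,\dots,u_{i-1},10^m,\varnothing,\dots,\varnothing)$ ($1\le i\le m+1$, $u_j$ non-empty or empty $m$-Dyck paths) and $w$ is any $m$-Dyck path with $w\ge v$ in the greedy order.
   Context: An $m$-Dyck path of size $n$ is a word with $n$ letters $1$ (up steps $(+m,+m)$) and $mn$ letters $0$ (down steps $(+1,-1)$) whose lattice path from $(0,0)$ never goes strictly below the horizontal axis; $\varnothing$ is the empty path. A valley is an occurrence of $01$; a Dyck factor is a factor which is itself an $m$-Dyck path. The greedy $m$-Tamari order on paths of size $n$ is generated by the cover relations $w\triangleleft w'$, one per valley of $w$, where $w'$ is obtained by swapping the down step of the valley with the longest Dyck factor immediately following it. An interval is a pair $[v,w]$ of paths of the same size with $v\le w$; its size is that common size. $D(w_1,\dots,w_{m+1})$ denotes $1w_10\,w_20\cdots w_m0\,w_{m+1}$. For non-empty $w_1,w_2$, $w_1*w_2$ is obtained from $w_1$ by replacing its rightmost peak (last occurrence of $10^m$) by $w_2$. -}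

module Defs where

open import Data.Nat using (ℕ; zero; suc; _+_; _∸_; _≤_)
open import Data.Bool using (Bool; true; false; _∧_)
open import Data.List using (List; []; _∷_; _++_; length; replicate; drop; foldr)
open import Data.List.Relation.Unary.All using (All)
open import Data.Maybe using (Maybe; just; nothing)
open import Data.Product using (_×_; _,_; ∃; ∃-syntax; Σ-syntax)
open import Relation.Binary.PropositionalEquality using (_≡_)
open import Relation.Binary.Construct.Closure.ReflexiveTransitive using (Star)

-- Letters: U = 1 (up step (+m,+m)), D = 0 (down step (+1,-1)).
data Step : Set where
  U D : Step

Word : Set
Word = List Step

_==_ : Step → Step → Bool
U == U = true
D == D = true
_ == _ = false

data Walk (m : ℕ) : ℕ → Word → Set where
  done : Walk m 0 []
  up   : ∀ {h w} → Walk m (h + m) w → Walk m h (U ∷ w)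
  down : ∀ {h w} → Walk m h w → Walk m (suc h) (D ∷ w)

IsDyck : ℕ → Word → Set
IsDyck m w = Walk m 0 w

size : Word → ℕ
size []      = 0
size (U ∷ w) = suc (size w)
size (D ∷ w) = size w

-- Cover relation of the greedy m-Tamari order: w has a valley D U at
-- position after x; y = U ∷ y' is the longest Dyck factor immediately
-- following that down step; w' swaps the D with y.
Cover : ℕ → Word → Word → Set
Cover m w w' =
  ∃[ x ] ∃[ y' ] ∃[ z ]
    (w ≡ x ++ D ∷ (U ∷ y') ++ z)
  × IsDyck m (U ∷ y')
  × (∀ p q → (U ∷ y') ++ z ≡ p ++ q → IsDyck m p → length p ≤ length (U ∷ y'))
  × (w' ≡ x ++ (U ∷ y') ++ D ∷ z)

_≤[_]_ : Word → ℕ → Word → Set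
v ≤[ m ] w = Star (Cover m) v w

-- [v,w] is a greedy m-Tamari interval (v ≤ w implies equal size)
Interval : ℕ → Word → Word → Set
Interval m v w = IsDyck m v × IsDyck m w × v ≤[ m ] w

Interval⁺ : ℕ → Word → Word → Set
Interval⁺ m v w = Interval m v w × 1 ≤ size v

peak : ℕ → Word
peak m = U ∷ replicate m D

isPrefix : Word → Word → Bool
isPrefix []       _        = true
isPrefix (_ ∷ _)  []       = false
isPrefix (a ∷ p)  (b ∷ xs) = (a == b) ∧ isPrefix p xs

replaceLast : Word → Word → Word → Maybe Word
replaceLast p r []       = nothing
replaceLast p r (x ∷ xs) with replaceLast p r xs
... | just ys = just (x ∷ ys)
... | nothing with isPrefix p (x ∷ xs)
...   | true  = just (r ++ drop (length p) (x ∷ xs))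
...   | false = nothing

-- w₁ * w₂ : replace the rightmost peak 1 0^m of w₁ by w₂
-- (if w₁ has no such peak, w₁ is returned; irrelevant for non-empty paths)
star : ℕ → Word → Word → Word
star m w₁ w₂ with replaceLast (peak m) w₂ w₁
... | just r  = r
... | nothing = w₁

_⊛[_]_ : Word × Word → ℕ → Word × Word → Word × Word
(v₁ , w₁) ⊛[ m ] (v₂ , w₂) = (star m v₁ v₂ , star m w₁ w₂)

unit : ℕ → Word × Word
unit m = (peak m , peak m)

prod : ℕ → List (Word × Word) → Word × Word
prod m = foldr (λ a b → a ⊛[ m ] b) (unit m)

-- D(w₁,…,w_k) = 1 w₁ 0 w₂ 0 ⋯ w_{k-1} 0 w_k  (used with k = m+1)
Dbody : List Word → Word
Dbody []           = []
Dbody (w ∷ [])     = w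
Dbody (w ∷ v ∷ ws) = w ++ D ∷ Dbody (v ∷ ws)

Dpath : List Word → Word
Dpath ws = U ∷ Dbody ws

-- lower paths of generators: D(u₁,…,u_{i-1},1 0^m,∅,…,∅), 1 ≤ i ≤ m+1,
-- u_j (possibly empty) m-Dyck paths; here us = (u₁,…,u_{i-1}), length us = i-1 ≤ m
GenLower : ℕ → Word → Set
GenLower m v =
  Σ[ us ∈ List Word ]
    (length us ≤ m)
  × All (IsDyck m) us
  × (v ≡ Dpath (us ++ peak m ∷ replicate (m ∸ length us) []))

IsGen : ℕ → Word × Word → Set
IsGen m (v , w) = GenLower m v × IsDyck m w × v ≤[ m ] w

{-# OPTIONS --safe #-}
-- A non-empty m-Dyck path ends with its last peak, a = x 1 0^m 0^j, and then
-- a * b = x b 0^j is b grafted at height j in place of that peak.  Heights make covers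
-- local: a Dyck factor can never stick out of the grafted b, so a cover of a * b is a
-- cover of a (whose rotated factor may contain all of b, standing in for the replaced
-- peak) or a cover of b.  This gives closure of intervals under *, and conversely lets
-- every chain above a * b be split into a chain above a and one above b.  A lower path
-- v = 1 v₁ 0 ⋯ 0 v_{m+1} whose last non-empty component is v_i equals g * v_i for the
-- generator g with 1 0^m in place i; as this decomposition is unique and the graft
-- point of an upper path is pinned down by heights, induction on size gives existence
-- and uniqueness of factorisations.

module Submission where

open import Defs
open import Data.Nat using (ℕ; zero; suc; _+_; _∸_; _≤_; z≤n; s≤s)
open import Data.Nat.Properties
  using (+-suc; +-comm; +-assoc; +-identityʳ; +-cancelˡ-≡; +-cancelʳ-≡; suc-injective;
         ≤-refl; ≤-trans; n≤1+n; 1+n≰n; ≤-reflexive; ≤-pred; m≤m+n; m≤n+m; m+n≡0⇒n≡0; m+1+n≰m;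
         m+[n∸m]≡n; m+n∸m≡n; module ≤-Reasoning)
open import Data.Nat.Tactic.RingSolver using (solve-∀)
open import Data.List using (List; []; _∷_; _++_; length; replicate; drop)
open import Data.List.Properties
  using (++-assoc; ++-identityʳ; ++-cancelˡ; ++-cancelʳ; ∷-injective; ∷-injectiveˡ; ∷-injectiveʳ;
         length-++; length-++-sucʳ; length-replicate)
open import Data.List.Relation.Unary.All as All using (All; []; _∷_)
open import Data.List.Relation.Unary.All.Properties using (++⁺; ++⁻ˡ; ++⁻ʳ; replicate⁺)
open import Data.Product using (_×_; _,_; proj₁; proj₂; ∃-syntax; map₁; uncurry)
open import Data.Sum using (_⊎_; inj₁; inj₂)
open import Data.Empty using (⊥; ⊥-elim)
open import Function using (_∘_; id)
open import Data.Maybe using (just; nothing)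
open import Data.Bool using (true)
open import Relation.Binary.PropositionalEquality
  using (_≡_; _≢_; refl; sym; trans; cong; cong₂; subst; module ≡-Reasoning)
open import Relation.Binary.Construct.Closure.ReflexiveTransitive as Star using (Star; ε; _◅_; _◅◅_)
open import Algebra.Solver.Monoid (Data.List.Properties.++-monoid Step) using (solve; _⊜_; _⊕_)

module _ {A : Set} where

  data Split++ (xs ys us vs : List A) : Set where
    prefixˡ : ∀ r → us ≡ xs ++ r → ys ≡ r ++ vs → Split++ xs ys us vs
    prefixʳ : ∀ c r → xs ≡ us ++ c ∷ r → vs ≡ c ∷ r ++ ys → Split++ xs ys us vs

  split++ : ∀ xs {ys} us {vs} → xs ++ ys ≡ us ++ vs → Split++ xs ys us vs
  split++ []       us       eq = prefixˡ us refl eq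
  split++ (x ∷ xs) []       eq = prefixʳ x xs refl (sym eq)
  split++ (x ∷ xs) (u ∷ us) eq with ∷-injective eq
  ... | refl , eq′ with split++ xs us eq′
  ...   | prefixˡ r e₁ e₂   = prefixˡ r (cong (x ∷_) e₁) e₂
  ...   | prefixʳ c r e₁ e₂ = prefixʳ c r (cong (x ∷_) e₁) e₂

  replicate-++ : ∀ a b {x : A} → replicate a x ++ replicate b x ≡ replicate (a + b) x
  replicate-++ zero    b = refl
  replicate-++ (suc a) b = cong (_ ∷_) (replicate-++ a b)

  replicate-split : ∀ n {x : A} us {vs} → replicate n x ≡ us ++ vs →
                    ∃[ k ] ∃[ l ] (us ≡ replicate k x × vs ≡ replicate l x)
  replicate-split n       []       eq = 0 , n , refl , sym eq
  replicate-split (suc n) (u ∷ us) eq with ∷-injective eq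
  ... | refl , eq′ with replicate-split n us eq′
  ...   | k , l , refl , refl = suc k , l , refl , refl

  replicate-infix : ∀ n {x : A} us {y vs} → replicate n x ≡ us ++ y ∷ vs → y ≡ x
  replicate-infix n us eq with replicate-split n us eq
  ... | _ , suc _ , _ , refl = refl

split-at-length : ∀ {A : Set} a b (xs : List A) → length xs ≡ a + suc b →
                  ∃[ ys ] ∃[ y ] ∃[ zs ] (xs ≡ ys ++ y ∷ zs × length ys ≡ a × length zs ≡ b)
split-at-length zero    b (x ∷ xs) len = [] , x , xs , refl , refl , suc-injective len
split-at-length (suc a) b (x ∷ xs) len with split-at-length a b xs (suc-injective len)
... | ys , y , zs , refl , len₁ , len₂ = x ∷ ys , y , zs , refl , cong suc len₁ , len₂

+-right-comm : ∀ a b c → a + b + c ≡ a + c + b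
+-right-comm = solve-∀

+-suc-comm : ∀ m a b → a + suc (m + b) ≡ suc m + (a + b)
+-suc-comm = solve-∀

Ds : ℕ → Word
Ds n = replicate n D

size-++ : ∀ a b → size (a ++ b) ≡ size a + size b
size-++ []      b = refl
size-++ (U ∷ a) b = cong suc (size-++ a b)
size-++ (D ∷ a) b = size-++ a b

size-++Ds : ∀ w n → size (w ++ Ds n) ≡ size w
size-++Ds []      zero    = refl
size-++Ds []      (suc n) = size-++Ds [] n
size-++Ds (U ∷ w) n       = cong suc (size-++Ds w n)
size-++Ds (D ∷ w) n       = size-++Ds w n

size-++-Dʳ : ∀ xs ys → size (xs ++ D ∷ ys) ≡ size (xs ++ ys)
size-++-Dʳ []       ys = refl
size-++-Dʳ (U ∷ xs) ys = cong suc (size-++-Dʳ xs ys)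
size-++-Dʳ (D ∷ xs) ys = size-++-Dʳ xs ys

moving-D-invariant : (f : Word → ℕ) {g : ℕ → ℕ} → (∀ xs ys → f (xs ++ D ∷ ys) ≡ g (f (xs ++ ys))) →
                     ∀ p y z → f (p ++ D ∷ y ++ z) ≡ f (p ++ y ++ D ∷ z)
moving-D-invariant f {g} f-D p y z = begin
  f (p ++ D ∷ y ++ z)   ≡⟨ f-D p (y ++ z) ⟩
  g (f (p ++ y ++ z))   ≡⟨ cong (g ∘ f) (++-assoc p y z) ⟨
  g (f ((p ++ y) ++ z)) ≡⟨ f-D (p ++ y) z ⟨
  f ((p ++ y) ++ D ∷ z) ≡⟨ cong f (++-assoc p y (D ∷ z)) ⟩
  f (p ++ y ++ D ∷ z)   ∎
  where open ≡-Reasoning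

nonempty-of-size : ∀ {w} → 1 ≤ size w → w ≢ []
nonempty-of-size () refl

isPrefix-Ds : ∀ a b → isPrefix (Ds a) (Ds (a + b)) ≡ true
isPrefix-Ds zero    b = refl
isPrefix-Ds (suc a) b = isPrefix-Ds a b

drop-Ds : ∀ a b → drop a (Ds (a + b)) ≡ Ds b
drop-Ds zero    b = refl
drop-Ds (suc a) b = drop-Ds a b

replaceLast-++ : ∀ p {r s t} x → replaceLast p r s ≡ just t → replaceLast p r (x ++ s) ≡ just (x ++ t)
replaceLast-++ p []      e = e
replaceLast-++ p {r} {s} {t} (c ∷ x) e with replaceLast p r (x ++ s) | replaceLast-++ p {r} {s} {t} x e
... | .(just (x ++ t)) | refl = refl

nest-Ds : ∀ x y u k j → x ++ (y ++ u ++ Ds k) ++ Ds j ≡ (x ++ y) ++ u ++ Ds (k + j)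
nest-Ds x y u k j = trans
  (solve 5 (λ x y u r s → x ⊕ (y ⊕ u ⊕ r) ⊕ s ⊜ (x ⊕ y) ⊕ u ⊕ (r ⊕ s)) refl x y u (Ds k) (Ds j))
  (cong (λ t → (x ++ y) ++ u ++ t) (replicate-++ k j))

data DownOrEnd : Word → Set where
  end  : DownOrEnd []
  down : ∀ z → DownOrEnd (D ∷ z)

DownOrEnd-Ds : ∀ n → DownOrEnd (Ds n)
DownOrEnd-Ds zero    = end
DownOrEnd-Ds (suc n) = down (Ds n)

DownOrEnd-++Ds : ∀ {z} n → DownOrEnd z → DownOrEnd (z ++ Ds n)
DownOrEnd-++Ds n end      = DownOrEnd-Ds n
DownOrEnd-++Ds n (down z) = down (z ++ Ds n)

DownOrEnd-prefix : ∀ t {s} → DownOrEnd (t ++ s) → DownOrEnd t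
DownOrEnd-prefix []      _        = end
DownOrEnd-prefix (D ∷ t) (down _) = down t

DownOrEnd-regraft : ∀ t {X X′} → DownOrEnd (t ++ U ∷ X) → DownOrEnd (t ++ X′)
DownOrEnd-regraft (D ∷ t) (down _) = down (t ++ _)

joinD : List Word → Word
joinD []       = []
joinD (u ∷ us) = u ++ D ∷ joinD us

joinD-++ : ∀ us vs → joinD (us ++ vs) ≡ joinD us ++ joinD vs
joinD-++ []       vs = refl
joinD-++ (u ∷ us) vs = trans (cong (λ t → u ++ D ∷ t) (joinD-++ us vs)) (sym (++-assoc u (D ∷ joinD us) (joinD vs)))

Dbody-padded : ∀ us w k → Dbody (us ++ w ∷ replicate k []) ≡ joinD us ++ w ++ Ds k
Dbody-padded []            w zero    = sym (++-identityʳ w)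
Dbody-padded []            w (suc k) = cong (λ t → w ++ D ∷ t) (Dbody-padded [] [] k)
Dbody-padded (u ∷ [])      w k = trans (cong (λ t → u ++ D ∷ t) (Dbody-padded [] w k)) (sym (++-assoc u (D ∷ []) _))
Dbody-padded (u ∷ u′ ∷ us) w k =
  trans (cong (λ t → u ++ D ∷ t) (Dbody-padded (u′ ∷ us) w k)) (sym (++-assoc u (D ∷ joinD (u′ ∷ us)) _))

Dbody-empties : ∀ {L k} → All (_≡ []) L → length L ≡ suc k → Dbody L ≡ Ds k
Dbody-empties {k = zero}  (refl ∷ [])         _   = refl
Dbody-empties {k = suc k} (refl ∷ e ∷ empties) len = cong (D ∷_) (Dbody-empties (e ∷ empties) (suc-injective len))

last-nonempty : (L : List Word) → All (_≡ []) L ⊎ ∃[ us ] ∃[ c ] ∃[ v ] ∃[ k ] (L ≡ us ++ (c ∷ v) ∷ replicate k [])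
last-nonempty [] = inj₁ []
last-nonempty (w ∷ L) with last-nonempty L
... | inj₂ (us , c , v , k , refl) = inj₂ (w ∷ us , c , v , k , refl)
last-nonempty ([] ∷ L)      | inj₁ empties = inj₁ (refl ∷ empties)
last-nonempty ((c ∷ v) ∷ L) | inj₁ empties = inj₂ ([] , c , v , length L , cong ((c ∷ v) ∷_) (all-empty empties))
  where
    all-empty : ∀ {L} → All (_≡ []) L → L ≡ replicate (length L) []
    all-empty []             = refl
    all-empty (refl ∷ empty) = cong ([] ∷_) (all-empty empty)

padded-length : ∀ {m} us (w : Word) → length us ≤ m → length (us ++ w ∷ replicate (m ∸ length us) []) ≡ suc m
padded-length {m} us w le = begin
  length (us ++ w ∷ replicate (m ∸ length us) []) ≡⟨ trans (length-++ us) (cong (λ n → length us + suc n) (length-replicate _)) ⟩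
  length us + suc (m ∸ length us)                 ≡⟨ +-suc (length us) _ ⟩
  suc (length us + (m ∸ length us))               ≡⟨ cong suc (m+[n∸m]≡n le) ⟩
  suc m                                           ∎
  where open ≡-Reasoning

padded-length⁻¹ : ∀ {m} us {w : Word} {k} → length (us ++ w ∷ replicate k []) ≡ suc m →
                  length us ≤ m × k ≡ m ∸ length us
padded-length⁻¹ {m} us {k = k} len =
  subst (length us ≤_) us+k≡m (m≤m+n _ k) , trans (sym (m+n∸m≡n (length us) k)) (cong (_∸ length us) us+k≡m)
  where
    us+k≡m : length us + k ≡ m
    us+k≡m = suc-injective (trans (sym (+-suc (length us) k))
      (trans (cong (λ n → length us + suc n) (sym (length-replicate k))) (trans (sym (length-++ us)) len)))

padded-injective : ∀ us us₂ {V V₂ : Word} {k k₂} → us ++ V ∷ replicate k [] ≡ us₂ ++ V₂ ∷ replicate k₂ [] →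
                   V ≢ [] → V₂ ≢ [] → us ≡ us₂ × V ≡ V₂
padded-injective []       []         eq _   _    = refl , ∷-injectiveˡ eq
padded-injective []       (_ ∷ us₂)  eq _   V₂≢[] = ⊥-elim (V₂≢[] (replicate-infix _ us₂ (∷-injectiveʳ eq)))
padded-injective (_ ∷ us) []         eq V≢[] _    = ⊥-elim (V≢[] (replicate-infix _ us (sym (∷-injectiveʳ eq))))
padded-injective (u ∷ us) (_ ∷ us₂)  eq V≢[] V₂≢[] with ∷-injective eq
... | refl , eq′ = map₁ (cong (u ∷_)) (padded-injective us us₂ eq′ V≢[] V₂≢[])

-- Height profiles

data Path (m : ℕ) : ℕ → ℕ → Word → Set where
  nil  : ∀ {h} → Path m h h []
  up   : ∀ {h e w} → Path m (h + m) e w → Path m h e (U ∷ w)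
  down : ∀ {h e w} → Path m h e w → Path m (suc h) e (D ∷ w)

Dyck : ℕ → Word → Set
Dyck m = Path m 0 0

module _ {m : ℕ} where

  walk⇒path : ∀ {h w} → Walk m h w → Path m h 0 w
  walk⇒path done     = nil
  walk⇒path (up p)   = up (walk⇒path p)
  walk⇒path (down p) = down (walk⇒path p)

  path⇒walk : ∀ {h w} → Path m h 0 w → Walk m h w
  path⇒walk nil      = done
  path⇒walk (up p)   = up (path⇒walk p)
  path⇒walk (down p) = down (path⇒walk p)

  _++ₚ_ : ∀ {h k e x y} → Path m h k x → Path m k e y → Path m h e (x ++ y)
  nil    ++ₚ q = q
  up p   ++ₚ q = up (p ++ₚ q)
  down p ++ₚ q = down (p ++ₚ q)

  record Cut (h e : ℕ) (x y : Word) : Set where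
    constructor cut
    field
      {height} : ℕ
      before   : Path m h height x
      after    : Path m height e y

  cutₚ : ∀ x {y h e} → Path m h e (x ++ y) → Cut h e x y
  cutₚ []      p        = cut nil p
  cutₚ (U ∷ x) (up p)   = let cut q r = cutₚ x p in cut (up q) r
  cutₚ (D ∷ x) (down p) = let cut q r = cutₚ x p in cut (down q) r

  drop-unique : ∀ {h e h′ e′ w} → Path m h e w → Path m h′ e′ w → h + e′ ≡ h′ + e
  drop-unique {h} {_} {h′} nil nil = +-comm h h′
  drop-unique {h} {e} {h′} {e′} (up p) (up q) = +-cancelʳ-≡ m _ _ (begin
    h + e′ + m   ≡⟨ +-right-comm h e′ m ⟩
    h + m + e′   ≡⟨ drop-unique p q ⟩
    h′ + m + e   ≡⟨ +-right-comm h′ m e ⟩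
    h′ + e + m   ∎)
    where open ≡-Reasoning
  drop-unique (down p) (down q) = cong suc (drop-unique p q)

  raise : ∀ {h e w} j → Path m h e w → Path m (h + j) (e + j) w
  raise j nil = nil
  raise {h} {e} {U ∷ w} j (up p) = up (subst (λ k → Path m k (e + j) w) (+-right-comm h m j) (raise j p))
  raise j (down p) = down (raise j p)

  Ds-Path : ∀ n → Path m n 0 (Ds n)
  Ds-Path zero    = nil
  Ds-Path (suc n) = down (Ds-Path n)

  descent-height : ∀ n {h e} → Path m h e (Ds n) → h ≡ n + e
  descent-height zero    nil      = refl
  descent-height (suc n) (down p) = cong suc (descent-height n p)

  Dyck-returns : ∀ {h e w} → Path m h e w → Dyck m w → e ≡ h
  Dyck-returns p d = trans (sym (drop-unique p d)) (+-identityʳ _)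

  graft : ∀ {h e} r b {b′} t → Path m h e (r ++ b ++ t) → Dyck m b → Dyck m b′ → Path m h e (r ++ b′ ++ t)
  graft r b t p db db′ with cutₚ r p
  ... | cut {k} q rest with cutₚ b rest
  ...   | cut q′ rest′ = q ++ₚ (raise k db′ ++ₚ subst (λ i → Path m i _ t) (Dyck-returns q′ db) rest′)

  peak-Dyck : Dyck m (peak m)
  peak-Dyck = up (Ds-Path m)

  height-before-Ds : ∀ {h} w j → Dyck m w → Path m h 0 (w ++ Ds j) → h ≡ j
  height-before-Ds w j dw p with cutₚ w p
  ... | cut q r = trans (sym (Dyck-returns q dw)) (trans (descent-height j r) (+-identityʳ j))

  descent-bound : ∀ {h e s} → Path m h e s → h ≤ length s + e
  descent-bound nil          = ≤-refl
  descent-bound {h} (up p)   = ≤-trans (m≤m+n h m) (≤-trans (descent-bound p) (n≤1+n _))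
  descent-bound (down p)     = s≤s (descent-bound p)

  up-blocks-steepest-descent : ∀ {h e s} → Path m h e (U ∷ s) → h ≡ length (U ∷ s) + e → ⊥
  up-blocks-steepest-descent (up p) refl = 1+n≰n (≤-trans (m≤m+n _ m) (descent-bound p))

-- The product and its monoid laws

record LastPeak (m : ℕ) (w : Word) : Set where
  constructor lastPeak
  field
    prefix : Word
    depth  : ℕ
    shape  : w ≡ prefix ++ peak m ++ Ds depth

module _ {m : ℕ} where

  last-peak : ∀ {h w} → Path m h 0 w → w ≡ Ds h ⊎ LastPeak m w
  last-peak nil = inj₁ refl
  last-peak (up {h} p) with last-peak p
  ... | inj₁ refl = inj₂ (lastPeak [] h (cong (U ∷_) (trans (cong Ds (+-comm h m)) (sym (replicate-++ m h)))))
  ... | inj₂ (lastPeak x j e) = inj₂ (lastPeak (U ∷ x) j (cong (U ∷_) e))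
  last-peak (down p) with last-peak p
  ... | inj₁ e = inj₁ (cong (D ∷_) e)
  ... | inj₂ (lastPeak x j e) = inj₂ (lastPeak (D ∷ x) j (cong (D ∷_) e))

  last-peak⁺ : ∀ {w} → Dyck m w → 1 ≤ size w → LastPeak m w
  last-peak⁺ p s with last-peak p
  ... | inj₂ lp = lp
  last-peak⁺ p () | inj₁ refl

  replaceLast-Ds : ∀ r n → replaceLast (peak m) r (Ds n) ≡ nothing
  replaceLast-Ds r zero = refl
  replaceLast-Ds r (suc n) rewrite replaceLast-Ds r n = refl

  replaceLast-peak : ∀ r j → replaceLast (peak m) r (peak m ++ Ds j) ≡ just (r ++ Ds j)
  replaceLast-peak r j rewrite replicate-++ m j {D} | replaceLast-Ds r (m + j) | isPrefix-Ds m j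
                             | length-replicate m {D} | drop-Ds m j = refl

  star-lastPeak : ∀ x j b → star m (x ++ peak m ++ Ds j) b ≡ x ++ b ++ Ds j
  star-lastPeak x j b with replaceLast (peak m) b (x ++ peak m ++ Ds j)
                         | replaceLast-++ (peak m) {b} {peak m ++ Ds j} {b ++ Ds j} x (replaceLast-peak b j)
  ... | .(just (x ++ b ++ Ds j)) | refl = refl

  star-Dyck : ∀ {a b} → Dyck m a → 1 ≤ size a → Dyck m b → Dyck m (star m a b)
  star-Dyck {b = b} da sa db with last-peak⁺ da sa
  ... | lastPeak x j refl rewrite star-lastPeak x j b = graft x (peak m) (Ds j) da peak-Dyck db

  star-nested : ∀ x {Y Y′} y k j b → Y ≡ y ++ peak m ++ Ds k → y ++ b ++ Ds k ≡ Y′ →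
                star m (x ++ Y ++ Ds j) b ≡ x ++ Y′ ++ Ds j
  star-nested x y k j b refl refl = begin
    star m (x ++ (y ++ peak m ++ Ds k) ++ Ds j) b ≡⟨ cong (λ t → star m t b) (nest-Ds x y (peak m) k j) ⟩
    star m ((x ++ y) ++ peak m ++ Ds (k + j)) b   ≡⟨ star-lastPeak (x ++ y) (k + j) b ⟩
    (x ++ y) ++ b ++ Ds (k + j)                   ≡⟨ nest-Ds x y b k j ⟨
    x ++ (y ++ b ++ Ds k) ++ Ds j                 ∎
    where open ≡-Reasoning

  star-lastPeak-after : ∀ p q r j b → star m (p ++ q ++ r ++ peak m ++ Ds j) b ≡ p ++ q ++ r ++ b ++ Ds j
  star-lastPeak-after p q r j b = begin
    star m (p ++ q ++ r ++ peak m ++ Ds j) b  ≡⟨ cong (λ t → star m t b) (reassoc (peak m)) ⟩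
    star m ((p ++ q ++ r) ++ peak m ++ Ds j) b ≡⟨ star-lastPeak (p ++ q ++ r) j b ⟩
    (p ++ q ++ r) ++ b ++ Ds j                ≡⟨ reassoc b ⟨
    p ++ q ++ r ++ b ++ Ds j                  ∎
    where
      open ≡-Reasoning
      reassoc : ∀ u → p ++ q ++ r ++ u ++ Ds j ≡ (p ++ q ++ r) ++ u ++ Ds j
      reassoc u = solve 5 (λ p q r u s → p ⊕ q ⊕ r ⊕ u ⊕ s ⊜ (p ⊕ q ⊕ r) ⊕ u ⊕ s) refl p q r u (Ds j)

  size-star : ∀ {a} b → Dyck m a → 1 ≤ size a → size b ≤ size (star m a b)
  size-star b da sa with last-peak⁺ da sa
  ... | lastPeak x j refl = begin
    size b                    ≤⟨ m≤n+m (size b) (size x) ⟩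
    size x + size b           ≡⟨ cong (size x +_) (size-++Ds b j) ⟨
    size x + size (b ++ Ds j) ≡⟨ size-++ x _ ⟨
    size (x ++ b ++ Ds j)     ≡⟨ cong size (star-lastPeak x j b) ⟨
    size (star m (x ++ peak m ++ Ds j) b) ∎
    where open ≤-Reasoning

  lastPeak-length : ∀ y j → length (y ++ peak m ++ Ds j) ≡ suc m + (length y + j)
  lastPeak-length y j = begin
    length (y ++ peak m ++ Ds j)          ≡⟨ length-++ y ⟩
    length y + suc (length (Ds m ++ Ds j)) ≡⟨ cong (λ w → length y + suc (length w)) (replicate-++ m j) ⟩
    length y + suc (length (Ds (m + j)))   ≡⟨ cong (λ n → length y + suc n) (length-replicate (m + j)) ⟩
    length y + suc (m + j)                 ≡⟨ +-suc-comm m (length y) j ⟩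
    suc m + (length y + j)                 ∎
    where open ≡-Reasoning

  star-identityˡ : ∀ v → star m (peak m) v ≡ v
  star-identityˡ v = trans (cong (λ t → star m t v) (sym (++-identityʳ (peak m)))) (trans (star-lastPeak [] 0 v) (++-identityʳ v))

  star-identityʳ : ∀ {v} → Dyck m v → 1 ≤ size v → star m v (peak m) ≡ v
  star-identityʳ dv sv with last-peak⁺ dv sv
  ... | lastPeak x j refl = star-lastPeak x j (peak m)

  star-assoc : ∀ {a b} c → Dyck m a → 1 ≤ size a → Dyck m b → 1 ≤ size b →
               star m (star m a b) c ≡ star m a (star m b c)
  star-assoc c da sa db sb with last-peak⁺ da sa | last-peak⁺ db sb
  ... | lastPeak x j refl | lastPeak y k refl = begin
    star m (star m (x ++ peak m ++ Ds j) (y ++ peak m ++ Ds k)) c ≡⟨ cong (λ t → star m t c) (star-lastPeak x j _) ⟩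
    star m (x ++ (y ++ peak m ++ Ds k) ++ Ds j) c               ≡⟨ star-nested x y k j c refl refl ⟩
    x ++ (y ++ c ++ Ds k) ++ Ds j                               ≡⟨ cong (λ t → x ++ t ++ Ds j) (star-lastPeak y k c) ⟨
    x ++ star m (y ++ peak m ++ Ds k) c ++ Ds j                 ≡⟨ star-lastPeak x j _ ⟨
    star m (x ++ peak m ++ Ds j) (star m (y ++ peak m ++ Ds k) c) ∎
    where open ≡-Reasoning

-- Covers as rotations

-- The maximality of the Dyck factor in a cover is replaced by the local
-- condition that the factor is not followed by an up step.
data Rotation (m : ℕ) (w w′ : Word) : Set where
  rotation : ∀ p y z → w ≡ p ++ D ∷ (U ∷ y) ++ z → Dyck m (U ∷ y) → DownOrEnd z →
             w′ ≡ p ++ (U ∷ y) ++ D ∷ z → Rotation m w w′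

record Passages (m j h : ℕ) (w : Word) : Set where
  constructor passages
  field
    factors : List Word
    rest    : Word
    count   : length factors ≡ j
    dyck    : All (Dyck m) factors
    path    : Path m h 0 rest
    shape   : w ≡ joinD factors ++ rest

module _ {m : ℕ} where

  joinD-Path : ∀ {us} k → All (Dyck m) us → Path m (length us + k) k (joinD us)
  joinD-Path k []                   = nil
  joinD-Path {u ∷ us} k (du ∷ dus) = raise (suc (length us + k)) du ++ₚ down (joinD-Path k dus)

  up-joinD-Dyck : ∀ {us e} k → length us + k ≡ m → All (Dyck m) us → Path m k 0 e → Dyck m (U ∷ joinD us ++ e)
  up-joinD-Dyck k len dus pe = up (subst (λ i → Path m i 0 _) len (joinD-Path k dus ++ₚ pe))

  -- w = f₁ 0 f₂ 0 ⋯ f_j 0 r, where f_i 0 is the first passage from height h + j − i + 1 down to h + j − i.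
  first-passages : ∀ j {h n w} → n ≡ j + h → Path m n 0 w → Passages m j h w
  first-passages zero    {w = w} refl p = passages [] w refl [] p refl
  first-passages (suc j) refl (down p) with first-passages j refl p
  ... | passages ds r len dds pr refl = passages ([] ∷ ds) r (cong suc len) (nil ∷ dds) pr refl
  first-passages (suc j) {h} refl (up p)
    with first-passages (m + suc j) (trans (+-comm _ m) (sym (+-assoc m (suc j) h))) p
  ... | passages ds r len dds pr refl with split-at-length m j ds len
  ...   | es , e₀ , rest , refl , len-es , len-rest with ++⁻ˡ es dds | ++⁻ʳ es dds
  ...     | des | de₀ ∷ drest =
    passages ((U ∷ joinD es ++ e₀) ∷ rest) r (cong suc len-rest)
             (up-joinD-Dyck 0 (trans (+-identityʳ _) len-es) des de₀ ∷ drest) pr (cong (U ∷_) regroup)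
    where
      regroup : joinD (es ++ e₀ ∷ rest) ++ r ≡ ((joinD es ++ e₀) ++ D ∷ joinD rest) ++ r
      regroup = trans (cong (_++ r) (joinD-++ es (e₀ ∷ rest)))
        (solve 4 (λ a b c d → (a ⊕ b ⊕ c) ⊕ d ⊜ ((a ⊕ b) ⊕ c) ⊕ d) refl (joinD es) e₀ (D ∷ joinD rest) r)

  up-starts-Dyck-factor : ∀ {h z} → Path m h 0 (U ∷ z) → ∃[ f ] ∃[ r ] (z ≡ f ++ r × Dyck m (U ∷ f))
  up-starts-Dyck-factor {h} (up p) with first-passages m (+-comm h m) p
  ... | passages ds r len dds _ refl =
    joinD ds ++ [] , r , cong (_++ r) (sym (++-identityʳ _)) , up-joinD-Dyck 0 (trans (+-identityʳ _) len) dds nil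

  suffix-blocks-down : ∀ {h e} s {t} → Path m h 0 s → Path m 0 e (s ++ D ∷ t) → ⊥
  suffix-blocks-down {h} s ps p with cutₚ s p
  ... | cut q (down _) with m+n≡0⇒n≡0 h (drop-unique ps q)
  ...   | ()

  cover⇒rotation : ∀ {w w′} → Dyck m w → Cover m w w′ → Rotation m w w′
  cover⇒rotation dw (x , y , z , refl , dy , maximal , refl) = rotation x y z refl (walk⇒path dy) (not-up z refl) refl
    where
      not-up : ∀ z′ → z′ ≡ z → DownOrEnd z
      not-up []       refl = end
      not-up (D ∷ z′) refl = down z′
      not-up (U ∷ z′) refl with cutₚ x dw
      ... | cut _ (down p) with cutₚ (U ∷ y) p
      ...   | cut _ q with up-starts-Dyck-factor q
      ...     | f , r , refl , df = ⊥-elim (too-long (maximal ((U ∷ y) ++ U ∷ f) r (sym (++-assoc (U ∷ y) (U ∷ f) r))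
                                                     (path⇒walk (walk⇒path dy ++ₚ df))))
        where
          too-long : length ((U ∷ y) ++ U ∷ f) ≤ length (U ∷ y) → ⊥
          too-long le = m+1+n≰m (length (U ∷ y)) (≤-trans (≤-reflexive (sym (length-++ (U ∷ y)))) le)

  rotation⇒cover : ∀ {w w′} → Rotation m w w′ → Cover m w w′
  rotation⇒cover (rotation p y z eq dy dz eq′) = p , y , z , eq , path⇒walk dy , maximal dz , eq′
    where
      maximal : ∀ {z} → DownOrEnd z → ∀ f r → (U ∷ y) ++ z ≡ f ++ r → IsDyck m f → length f ≤ length (U ∷ y)
      maximal dz f r eq df with split++ (U ∷ y) f eq
      ... | prefixʳ c t e _ = ≤-trans (m≤m+n _ _) (≤-reflexive (sym (trans (cong length e) (length-++ f))))
      ... | prefixˡ [] refl _ = ≤-reflexive (cong length (++-identityʳ (U ∷ y)))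
      ... | prefixˡ (c ∷ t) refl eq₂ with dz | eq₂
      ...   | down _ | refl = ⊥-elim (suffix-blocks-down (U ∷ y) dy (walk⇒path df))

  rotation-Path : ∀ {h w w′} → Rotation m w w′ → Path m h 0 w → Path m h 0 w′
  rotation-Path (rotation p y z refl dy _ refl) pw with cutₚ p pw
  ... | cut {suc k} q (down r) with cutₚ (U ∷ y) r
  ...   | cut q′ r′ = q ++ₚ (raise (suc k) dy ++ₚ down (subst (λ i → Path m i 0 z) (Dyck-returns q′ dy) r′))

  rotation-size : ∀ {w w′} → Rotation m w w′ → size w ≡ size w′
  rotation-size (rotation p y z refl _ _ refl) = moving-D-invariant size {λ n → n} size-++-Dʳ p (U ∷ y) z

  rotation-length : ∀ {w w′} → Rotation m w w′ → length w ≡ length w′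
  rotation-length (rotation p y z refl _ _ refl) = moving-D-invariant length {suc} (λ xs → length-++-sucʳ xs D) p (U ∷ y) z

  ≤⇒rotations : ∀ {v w} → Dyck m v → v ≤[ m ] w → Star (Rotation m) v w
  ≤⇒rotations dv ε        = ε
  ≤⇒rotations dv (c ◅ cs) = let ρ = cover⇒rotation dv c in ρ ◅ ≤⇒rotations (rotation-Path ρ dv) cs

  ≤-Dyck : ∀ {v w} → Dyck m v → v ≤[ m ] w → Dyck m w
  ≤-Dyck dv v≤w = Star.fold (λ v w → Dyck m v → Dyck m w) (λ ρ f → f ∘ rotation-Path ρ) id (≤⇒rotations dv v≤w) dv

  ≤-size : ∀ {v w} → Dyck m v → v ≤[ m ] w → size v ≡ size w
  ≤-size dv v≤w = Star.fold (λ v w → size v ≡ size w) (trans ∘ rotation-size) refl (≤⇒rotations dv v≤w)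

  ≤-length : ∀ {v w} → Dyck m v → v ≤[ m ] w → length v ≡ length w
  ≤-length dv v≤w = Star.fold (λ v w → length v ≡ length w) (trans ∘ rotation-length) refl (≤⇒rotations dv v≤w)

  ≤-Dyck⁺ : ∀ {v w} → Dyck m v → 1 ≤ size v → v ≤[ m ] w → Dyck m w × 1 ≤ size w
  ≤-Dyck⁺ dv sv v≤w = ≤-Dyck dv v≤w , subst (1 ≤_) (≤-size dv v≤w) sv

  Dyck⁺-starts-up : ∀ {w} → Dyck m w → 1 ≤ size w → ∃[ b ] w ≡ U ∷ b
  Dyck⁺-starts-up (up _) _ = _ , refl

  Dyck-starts-up : ∀ y₁ {X} → Dyck m (y₁ ++ U ∷ X) → ∃[ y ] y₁ ++ U ∷ X ≡ U ∷ y
  Dyck-starts-up []       _ = _ , refl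
  Dyck-starts-up (U ∷ y₁) _ = _ , refl

-- Closure of intervals under the product

module _ {m : ℕ} where

  rotation-starʳ : ∀ {a b b′} → Dyck m a → 1 ≤ size a → Rotation m b b′ → Rotation m (star m a b) (star m a b′)
  rotation-starʳ da sa (rotation p y z refl dy dz refl) with last-peak⁺ da sa
  ... | lastPeak x j refl =
    rotation (x ++ p) y (z ++ Ds j) (graft-regroup (D ∷ U ∷ y) z) dy (DownOrEnd-++Ds j dz) (graft-regroup (U ∷ y) (D ∷ z))
    where
      graft-regroup : ∀ u z → star m (x ++ peak m ++ Ds j) (p ++ u ++ z) ≡ (x ++ p) ++ u ++ z ++ Ds j
      graft-regroup u z = trans (star-lastPeak x j _)
        (solve 5 (λ x p u z s → x ⊕ (p ⊕ u ⊕ z) ⊕ s ⊜ (x ⊕ p) ⊕ u ⊕ z ⊕ s) refl x p u z (Ds j))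

  rotation-starˡ : ∀ {a a′ b} → Dyck m a → Rotation m a a′ → Dyck m (U ∷ b) →
                   Rotation m (star m a (U ∷ b)) (star m a′ (U ∷ b))
  rotation-starˡ da (rotation p y z refl dy dz refl) db with cutₚ p da
  ... | cut _ (down r) with cutₚ (U ∷ y) r
  ...   | cut _ pz with last-peak pz
  ...     | inj₂ (lastPeak z₁ j refl) =
    rotation p y (z₁ ++ _ ++ Ds j) (star-lastPeak-after p (D ∷ U ∷ y) z₁ j _) dy (DownOrEnd-regraft z₁ dz)
             (star-lastPeak-after p (U ∷ y) (D ∷ z₁) j _)
  ...     | inj₁ refl with last-peak⁺ dy (s≤s z≤n)
  ...       | lastPeak y₁ s shape with graft y₁ (peak m) (Ds s) (subst (Dyck m) shape dy) peak-Dyck db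
  ...         | dY with Dyck-starts-up y₁ dY
  ...           | y′ , shape′ = rotation p y′ (Ds _) in-valley (subst (Dyck m) shape′ dY) (DownOrEnd-Ds _)
                                         (star-nested p y₁ s (suc _) _ shape shape′)
    where
      in-valley : star m (p ++ D ∷ (U ∷ y) ++ Ds _) (U ∷ _) ≡ p ++ D ∷ (U ∷ y′) ++ Ds _
      in-valley = trans (cong (λ t → star m t _) (sym (++-assoc p (D ∷ []) _)))
                    (trans (star-nested (p ++ D ∷ []) y₁ s _ _ shape shape′) (++-assoc p (D ∷ []) _))

  ≤-starˡ : ∀ {a a′ b} → Dyck m a → a ≤[ m ] a′ → Dyck m (U ∷ b) → star m a (U ∷ b) ≤[ m ] star m a′ (U ∷ b)
  ≤-starˡ da ε        db = ε
  ≤-starˡ da (c ◅ cs) db = let ρ = cover⇒rotation da c in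
    rotation⇒cover (rotation-starˡ da ρ db) ◅ ≤-starˡ (rotation-Path ρ da) cs db

  ≤-starʳ : ∀ {a b b′} → Dyck m a → 1 ≤ size a → Dyck m b → b ≤[ m ] b′ → star m a b ≤[ m ] star m a b′
  ≤-starʳ da sa db ε        = ε
  ≤-starʳ da sa db (c ◅ cs) = let ρ = cover⇒rotation db c in
    rotation⇒cover (rotation-starʳ da sa ρ) ◅ ≤-starʳ da sa (rotation-Path ρ db) cs

  interval-star : ∀ {v₁ w₁ v₂ w₂} → Interval⁺ m v₁ w₁ → Interval⁺ m v₂ w₂ →
                  Interval⁺ m (star m v₁ v₂) (star m w₁ w₂)
  interval-star ((dv₁ , dw₁ , v₁≤w₁) , sv₁) ((dv₂ , dw₂ , v₂≤w₂) , sv₂)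
    with walk⇒path dv₁ | walk⇒path dv₂ | ≤-Dyck⁺ (walk⇒path dv₁) sv₁ v₁≤w₁ | Dyck⁺-starts-up (walk⇒path dv₂) sv₂
  ... | pv₁ | pv₂ | pw₁ , sw₁ | _ , refl =
    ( path⇒walk (star-Dyck pv₁ sv₁ pv₂) , path⇒walk (star-Dyck pw₁ sw₁ (walk⇒path dw₂))
    , ≤-starˡ pv₁ v₁≤w₁ pv₂ ◅◅ ≤-starʳ pw₁ sw₁ pv₂ v₂≤w₂ )
    , ≤-trans sv₂ (size-star _ pv₁ sv₁)

-- Chains above a product

data SplitRotation (m : ℕ) (a b c : Word) : Set where
  inLeft  : ∀ {a′} → Rotation m a a′ → c ≡ star m a′ b → SplitRotation m a b c
  inRight : ∀ {b′} → Rotation m b b′ → c ≡ star m a b′ → SplitRotation m a b c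

record StarAbove (m : ℕ) (a b w : Word) : Set where
  constructor starAbove
  field
    {left right} : Word
    left-above   : a ≤[ m ] left
    right-above  : b ≤[ m ] right
    shape        : w ≡ star m left right

module _ {m : ℕ} where

  valley-in-right : ∀ x j r {B y z} → Dyck m B → Dyck m (U ∷ y) → DownOrEnd z →
                    B ++ Ds j ≡ r ++ D ∷ (U ∷ y) ++ z →
                    SplitRotation m (x ++ peak m ++ Ds j) B ((x ++ r) ++ (U ∷ y) ++ D ∷ z)
  valley-in-right x j r {B} {y} dB dy dz eq with split++ B r eq
  ... | prefixˡ r′ refl e with replicate-infix j (r′ ++ D ∷ []) (trans e (sym (++-assoc r′ (D ∷ []) _)))
  ...   | ()
  valley-in-right x j r {y = y} dB dy dz eq | prefixʳ c r₃ refl e with ∷-injective e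
  ... | refl , e′ with split++ (U ∷ y) r₃ e′
  ...   | prefixˡ t refl refl = inRight (rotation r y t refl dy (DownOrEnd-prefix t dz) refl) (sym grafted)
    where
      grafted : star m (x ++ peak m ++ Ds j) (r ++ (U ∷ y) ++ D ∷ t) ≡ (x ++ r) ++ (U ∷ y) ++ D ∷ t ++ Ds j
      grafted = trans (star-lastPeak x j _)
        (solve 5 (λ x r Y t s → x ⊕ (r ⊕ Y ⊕ t) ⊕ s ⊜ (x ⊕ r) ⊕ Y ⊕ t ⊕ s) refl x r (U ∷ y) (D ∷ t) (Ds j))
  ...   | prefixʳ c′ t′ e″ e‴ with replicate-infix j [] e‴ | cutₚ r dB
  ...     | refl | cut _ (down pr₃) = ⊥-elim (suffix-blocks-down r₃ pr₃ (subst (Dyck m) e″ dy))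

  factor-around-graft : ∀ p r′ j k₂ k {b y} → Ds j ≡ Ds k₂ ++ Ds k → Dyck m (U ∷ b) → Dyck m (U ∷ y) →
                        U ∷ y ≡ r′ ++ (U ∷ b) ++ Ds k₂ →
                        SplitRotation m ((p ++ D ∷ r′) ++ peak m ++ Ds j) (U ∷ b) (p ++ (U ∷ y) ++ D ∷ Ds k)
  factor-around-graft p r′ j k₂ k eqD db dy eqY with graft r′ (U ∷ _) (Ds k₂) (subst (Dyck m) eqY dy) db peak-Dyck
  ... | dY with Dyck-starts-up r′ dY
  ...   | y′ , eqY′ =
    inLeft (rotation p y′ (Ds k) in-a (subst (Dyck m) eqY′ dY) (DownOrEnd-Ds k) refl)
           (sym (star-nested p r′ k₂ (suc k) _ (sym eqY′) (sym eqY)))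
    where
      open ≡-Reasoning
      in-a : (p ++ D ∷ r′) ++ peak m ++ Ds j ≡ p ++ D ∷ (U ∷ y′) ++ Ds k
      in-a = begin
        (p ++ D ∷ r′) ++ peak m ++ Ds j          ≡⟨ cong (λ t → (p ++ D ∷ r′) ++ peak m ++ t) eqD ⟩
        (p ++ D ∷ r′) ++ peak m ++ Ds k₂ ++ Ds k ≡⟨ solve 6 (λ p d r q s s′ → (p ⊕ d ⊕ r) ⊕ q ⊕ s ⊕ s′ ⊜ p ⊕ d ⊕ (r ⊕ q ⊕ s) ⊕ s′)
                                                          refl p (D ∷ []) r′ (peak m) (Ds k₂) (Ds k) ⟩
        p ++ D ∷ (r′ ++ peak m ++ Ds k₂) ++ Ds k ≡⟨ cong (λ t → p ++ D ∷ t ++ Ds k) eqY′ ⟩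
        p ++ D ∷ (U ∷ y′) ++ Ds k                ∎

  valley-in-left : ∀ p r′ j {b y z} → Dyck m (U ∷ b) → Dyck m (U ∷ y) → DownOrEnd z →
                   (U ∷ y) ++ z ≡ r′ ++ (U ∷ b) ++ Ds j →
                   SplitRotation m ((p ++ D ∷ r′) ++ peak m ++ Ds j) (U ∷ b) (p ++ (U ∷ y) ++ D ∷ z)
  valley-in-left p r′ j {b} {y} db dy dz eq with split++ (U ∷ y) r′ eq
  ... | prefixˡ t refl refl =
    inLeft (rotation p y (t ++ peak m ++ Ds j) in-a dy (DownOrEnd-regraft t dz) refl)
           (sym (star-lastPeak-after p (U ∷ y) (D ∷ t) j _))
    where
      in-a : (p ++ D ∷ (U ∷ y) ++ t) ++ peak m ++ Ds j ≡ p ++ D ∷ (U ∷ y) ++ t ++ peak m ++ Ds j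
      in-a = solve 5 (λ p Y t q s → (p ⊕ Y ⊕ t) ⊕ q ⊕ s ⊜ p ⊕ Y ⊕ t ⊕ q ⊕ s) refl p (D ∷ U ∷ y) t (peak m) (Ds j)
  ... | prefixʳ c t e₁ e₂ with split++ (U ∷ b) (c ∷ t) e₂
  ...   | prefixˡ t₂ e₃ e₄ with replicate-split j t₂ e₄
  ...     | k₂ , k , refl , refl = factor-around-graft p r′ j k₂ k e₄ db dy (trans e₁ (cong (r′ ++_) e₃))
  valley-in-left p r′ j db dy (down _) eq | prefixʳ c t e₁ e₂ | prefixʳ c′ t₃ e₃ refl
    with cutₚ r′ (subst (Dyck m) e₁ dy)
  ... | cut _ pt = ⊥-elim (suffix-blocks-down (c ∷ t) pt (subst (Dyck m) e₃ db))

  -- A factor rotated at a valley of x either ends inside x or contains all of the grafted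
  -- word, which then stands in for the peak of a; a valley inside the graft is one of b.
  rotation-of-graft : ∀ x j {b c} → Dyck m (U ∷ b) → Rotation m (x ++ (U ∷ b) ++ Ds j) c →
                      SplitRotation m (x ++ peak m ++ Ds j) (U ∷ b) c
  rotation-of-graft x j db (rotation p y z eq dy dz refl) with split++ x p eq
  ... | prefixˡ r refl e = valley-in-right x j r db dy dz e
  ... | prefixʳ c r′ refl e with ∷-injective e
  ...   | refl , e′ = valley-in-left p r′ j db dy dz e′

  rotation-of-star : ∀ {a b c} → Dyck m a → 1 ≤ size a → Dyck m b → 1 ≤ size b → Rotation m (star m a b) c →
                     SplitRotation m a b c
  rotation-of-star da sa db sb ρ with last-peak⁺ da sa | Dyck⁺-starts-up db sb
  ... | lastPeak x j refl | _ , refl = rotation-of-graft x j db (subst (λ w → Rotation m w _) (star-lastPeak x j _) ρ)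

  ≤-of-star : ∀ {a b w} → Dyck m a → 1 ≤ size a → Dyck m b → 1 ≤ size b → star m a b ≤[ m ] w → StarAbove m a b w
  ≤-of-star da sa db sb ε = starAbove ε ε refl
  ≤-of-star da sa db sb (c ◅ cs) with rotation-of-star da sa db sb (cover⇒rotation (star-Dyck da sa db) c)
  ... | inLeft ρ refl =
    let starAbove a≤ b≤ eq = ≤-of-star (rotation-Path ρ da) (subst (1 ≤_) (rotation-size ρ) sa) db sb cs
    in starAbove (rotation⇒cover ρ ◅ a≤) b≤ eq
  ... | inRight ρ refl =
    let starAbove a≤ b≤ eq = ≤-of-star da sa (rotation-Path ρ db) (subst (1 ≤_) (rotation-size ρ) sb) cs
    in starAbove a≤ (rotation⇒cover ρ ◅ b≤) eq

  peak-maximal : ∀ {w} → peak m ≤[ m ] w → w ≡ peak m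
  peak-maximal ε = refl
  peak-maximal ((p , y , z , eq , _) ◅ _) with p | eq
  ... | [] | ()
  ... | _ ∷ p′ | eq′ with replicate-infix m (p′ ++ D ∷ []) (trans (∷-injectiveʳ eq′) (sym (++-assoc p′ (D ∷ []) _)))
  ...   | ()

-- Generators and unique factorisation

record GenSplit (m : ℕ) (v : Word) : Set where
  constructor genSplit
  field
    {gen rest} : Word
    gen-lower  : GenLower m gen
    rest-Dyck  : Dyck m rest
    rest⁺      : 1 ≤ size rest
    shape      : v ≡ star m gen rest

module _ {m : ℕ} where

  private
    pad : List Word → List Word
    pad us = replicate (m ∸ length us) []

  gen-shape : ∀ us w → Dpath (us ++ w ∷ pad us) ≡ U ∷ joinD us ++ w ++ Ds (m ∸ length us)
  gen-shape us w = cong (U ∷_) (Dbody-padded us w _)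

  star-gen : ∀ us V → star m (Dpath (us ++ peak m ∷ pad us)) V ≡ U ∷ joinD us ++ V ++ Ds (m ∸ length us)
  star-gen us V = trans (cong (λ t → star m t V) (gen-shape us (peak m))) (star-lastPeak (U ∷ joinD us) _ V)

  gen-Dyck : ∀ {g} → GenLower m g → Dyck m g
  gen-Dyck (us , le , dus , refl) = subst (Dyck m) (sym (gen-shape us (peak m)))
    (up-joinD-Dyck k (m+[n∸m]≡n le) (All.map walk⇒path dus) (raise k peak-Dyck ++ₚ Ds-Path k))
    where
      k : ℕ
      k = m ∸ length us

  gen-size : ∀ {g} → GenLower m g → 1 ≤ size g
  gen-size (_ , _ , _ , refl) = s≤s z≤n

  gen-interval : ∀ {v w} → IsGen m (v , w) → Interval⁺ m v w
  gen-interval (gl , dw , v≤w) = (path⇒walk (gen-Dyck gl) , dw , v≤w) , gen-size gl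

  size-gen-star : ∀ {g} V → GenLower m g → suc (size V) ≤ size (star m g V)
  size-gen-star V (us , _ , _ , refl) = begin
    suc (size V)                              ≤⟨ s≤s (m≤n+m (size V) (size (joinD us))) ⟩
    suc (size (joinD us) + size V)            ≡⟨ cong (λ n → suc (size (joinD us) + n)) (size-++Ds V _) ⟨
    suc (size (joinD us) + size (V ++ Ds _))  ≡⟨ cong suc (size-++ (joinD us) _) ⟨
    size (U ∷ joinD us ++ V ++ Ds _)          ≡⟨ cong size (star-gen us V) ⟨
    size (star m (Dpath (us ++ peak m ∷ pad us)) V) ∎
    where open ≤-Reasoning

  Dyck-components : ∀ {v} → Dyck m v → 1 ≤ size v → ∃[ L ] (length L ≡ suc m × All (Dyck m) L × v ≡ Dpath L)
  Dyck-components (up p) _ with first-passages m (sym (+-identityʳ m)) p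
  ... | passages ds r len dds dr refl =
    ds ++ r ∷ [] , trans (length-++ ds) (trans (cong (_+ 1) len) (+-comm m 1)) , ++⁺ dds (dr ∷ []) ,
    cong (U ∷_) (sym (trans (Dbody-padded ds r 0) (cong (joinD ds ++_) (++-identityʳ r))))

  peak-or-gen-split : ∀ {v} → Dyck m v → 1 ≤ size v → v ≡ peak m ⊎ GenSplit m v
  peak-or-gen-split dv sv with Dyck-components dv sv
  ... | L , len , dL , refl with last-nonempty L
  ...   | inj₁ empties = inj₁ (cong (U ∷_) (Dbody-empties empties len))
  ...   | inj₂ (us , c , V , k , refl) with padded-length⁻¹ us len
  ...     | le , refl with ++⁻ʳ us dL
  ...       | dV@(up _) ∷ _ =
    inj₂ (genSplit (us , le , All.map path⇒walk (++⁻ˡ us dL) , refl) dV (s≤s z≤n)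
                   (trans (gen-shape us (c ∷ V)) (sym (star-gen us (c ∷ V)))))

  factorisation : ∀ n {v w} → size v ≤ n → Interval⁺ m v w → ∃[ gs ] (All (IsGen m) gs × prod m gs ≡ (v , w))
  factorisation zero    sv≤0 (_ , sv) with ≤-trans sv sv≤0
  ... | ()
  factorisation (suc n) sv≤n ((dv , _ , v≤w) , sv) with peak-or-gen-split (walk⇒path dv) sv
  ... | inj₁ refl = [] , [] , cong (peak m ,_) (sym (peak-maximal v≤w))
  ... | inj₂ (genSplit {g} gl dV sV refl) with ≤-of-star (gen-Dyck gl) (gen-size gl) dV sV v≤w
  ...   | starAbove {g′} g≤g′ V≤w′ refl
          with factorisation n (≤-pred (≤-trans (size-gen-star _ gl) sv≤n))
                             ((path⇒walk dV , path⇒walk (≤-Dyck dV V≤w′) , V≤w′) , sV)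
  ...     | gs , gens , eq =
    (g , g′) ∷ gs , (gl , path⇒walk (≤-Dyck (gen-Dyck gl) g≤g′) , g≤g′) ∷ gens , cong ((g , g′) ⊛[ m ]_) eq

  star-gen-Dpath : ∀ us V → star m (Dpath (us ++ peak m ∷ pad us)) V ≡ Dpath (us ++ V ∷ pad us)
  star-gen-Dpath us V = trans (star-gen us V) (sym (gen-shape us V))

  gen-components : ∀ {us V} → All (IsDyck m) us → Dyck m V → All (Dyck m) (us ++ V ∷ pad us)
  gen-components dus dV = ++⁺ (All.map walk⇒path dus) (dV ∷ replicate⁺ _ nil)

  unit-interval : Interval⁺ m (peak m) (peak m)
  unit-interval = (path⇒walk peak-Dyck , path⇒walk peak-Dyck , ε) , s≤s z≤n

  prod-interval : ∀ gs → All (IsGen m) gs → Interval⁺ m (proj₁ (prod m gs)) (proj₂ (prod m gs))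
  prod-interval []       []           = unit-interval
  prod-interval (_ ∷ gs) (gen ∷ gens) = interval-star (gen-interval gen) (prod-interval gs gens)

  peak-not-gen-star : ∀ {g V} → GenLower m g → 1 ≤ size V → peak m ≢ star m g V
  peak-not-gen-star {g} {V} gl sV eq = 1+n≰n (begin
    2                  ≤⟨ s≤s sV ⟩
    suc (size V)       ≤⟨ size-gen-star V gl ⟩
    size (star m g V)  ≡⟨ cong size eq ⟨
    size (peak m)      ≡⟨ cong suc (size-++Ds [] m) ⟩
    1                  ∎)
    where open ≤-Reasoning

  Dyck-prefix-unique : ∀ d d₂ {s s₂} → Dyck m d → Dyck m d₂ → d ++ D ∷ s ≡ d₂ ++ D ∷ s₂ → d ≡ d₂ × s ≡ s₂
  Dyck-prefix-unique d d₂ dd dd₂ eq with split++ d d₂ eq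
  ... | prefixˡ [] e₁ e₂ = sym (trans e₁ (++-identityʳ d)) , ∷-injectiveʳ e₂
  ... | prefixˡ (c ∷ t) refl e₂ with ∷-injective e₂
  ...   | refl , _ = ⊥-elim (suffix-blocks-down d dd dd₂)
  Dyck-prefix-unique d d₂ dd dd₂ eq | prefixʳ c t refl e₂ with ∷-injective e₂
  ... | refl , _ = ⊥-elim (suffix-blocks-down d₂ dd₂ dd)

  Dbody-injective : ∀ L L₂ → All (Dyck m) L → All (Dyck m) L₂ → length L ≡ length L₂ →
                    Dbody L ≡ Dbody L₂ → L ≡ L₂
  Dbody-injective []          []            _           _             _   _  = refl
  Dbody-injective (w ∷ [])    (w₂ ∷ [])     _           _             _   eq = cong (_∷ []) eq
  Dbody-injective (w ∷ v ∷ L) (w₂ ∷ v₂ ∷ L₂) (dw ∷ dL) (dw₂ ∷ dL₂) len eq with Dyck-prefix-unique w w₂ dw dw₂ eq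
  ... | refl , eq′ = cong (w ∷_) (Dbody-injective (v ∷ L) (v₂ ∷ L₂) dL dL₂ (suc-injective len) eq′)
  Dbody-injective []          (_ ∷ _)       _ _ () _
  Dbody-injective (_ ∷ _)     []            _ _ () _
  Dbody-injective (_ ∷ [])    (_ ∷ _ ∷ _)   _ _ () _
  Dbody-injective (_ ∷ _ ∷ _) (_ ∷ [])      _ _ () _

  gen-star-injective : ∀ {g h V V₂} → GenLower m g → GenLower m h →
                       Dyck m V → 1 ≤ size V → Dyck m V₂ → 1 ≤ size V₂ →
                       star m g V ≡ star m h V₂ → g ≡ h × V ≡ V₂
  gen-star-injective {V = V} {V₂} (us , le , dus , refl) (us₂ , le₂ , dus₂ , refl) dV sV dV₂ sV₂ eq
    with Dbody-injective _ _ (gen-components dus dV) (gen-components dus₂ dV₂)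
           (trans (padded-length us V le) (sym (padded-length us₂ V₂ le₂)))
           (∷-injectiveʳ (trans (sym (star-gen-Dpath us V)) (trans eq (star-gen-Dpath us₂ V₂))))
  ... | eqL with padded-injective us us₂ eqL (nonempty-of-size sV) (nonempty-of-size sV₂)
  ...   | refl , refl = refl , refl

  -- Otherwise the word s between the two graft points would fall from height j to
  -- j − |s|, one step per letter, though it begins with the first up step of b.
  graft-offset-empty : ∀ y s {b b₂ j j₂} → Dyck m b → 1 ≤ size b → Dyck m b₂ → Dyck m (y ++ b ++ Ds j) →
                       y ++ b ++ Ds j ≡ (y ++ s) ++ b₂ ++ Ds j₂ → length y + j ≡ length (y ++ s) + j₂ → s ≡ []
  graft-offset-empty y []      _  _  _   _  _  _   = refl
  graft-offset-empty y (c ∷ r) {j = j} {j₂} db sb db₂ dW eq len with Dyck⁺-starts-up db sb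
  ... | _ , refl with ∷-injectiveˡ (++-cancelˡ y _ _ (trans eq (++-assoc y (c ∷ r) _)))
  ...   | refl with cutₚ y dW | cutₚ (y ++ U ∷ r) (subst (Dyck m) eq dW)
  ...     | cut q₁ rest₁ | cut q₂ rest₂ with cutₚ y q₂
  ...       | cut q₃ step = ⊥-elim (up-blocks-steepest-descent step (begin
    _                       ≡⟨ drop-unique q₃ q₁ ⟨
    _                       ≡⟨ height-before-Ds _ j db rest₁ ⟩
    j                       ≡⟨ depth-offset ⟩
    length (U ∷ r) + j₂     ≡⟨ cong (length (U ∷ r) +_) (height-before-Ds _ j₂ db₂ rest₂) ⟨
    length (U ∷ r) + _      ∎))
    where
      open ≡-Reasoning
      depth-offset : j ≡ length (U ∷ r) + j₂
      depth-offset = +-cancelˡ-≡ (length y) _ _ (trans len (trans (cong (_+ j₂) (length-++ y)) (+-assoc (length y) _ j₂)))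

  graft-cancel : ∀ y y₂ {b b₂ j j₂} → Dyck m b → 1 ≤ size b → Dyck m b₂ → 1 ≤ size b₂ →
                 Dyck m (y ++ b ++ Ds j) → length y + j ≡ length y₂ + j₂ →
                 y ++ b ++ Ds j ≡ y₂ ++ b₂ ++ Ds j₂ → y ≡ y₂ × j ≡ j₂ × b ≡ b₂
  graft-cancel y y₂ {b} {b₂} {j} {j₂} db sb db₂ sb₂ dW len eq with split++ y y₂ eq
  ... | prefixˡ s refl e₂ with graft-offset-empty y s db sb db₂ dW eq len
  ...   | refl = sym (++-identityʳ y) , j≡j₂ , ++-cancelʳ (Ds j) b b₂ (trans e₂ (cong (λ n → b₂ ++ Ds n) (sym j≡j₂)))
    where
      j≡j₂ : j ≡ j₂
      j≡j₂ = +-cancelˡ-≡ (length y) _ _ (trans len (cong (λ w → length w + j₂) (++-identityʳ y)))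
  graft-cancel y y₂ db sb db₂ sb₂ dW len eq | prefixʳ c r refl e₂
    with graft-offset-empty y₂ (c ∷ r) db₂ sb₂ db (subst (Dyck m) eq dW) (sym eq) (sym len)
  ... | ()

  star-cancel : ∀ {a a₂ b b₂} → Dyck m a → 1 ≤ size a → Dyck m a₂ → 1 ≤ size a₂ → length a ≡ length a₂ →
                Dyck m b → 1 ≤ size b → Dyck m b₂ → 1 ≤ size b₂ →
                star m a b ≡ star m a₂ b₂ → a ≡ a₂ × b ≡ b₂
  star-cancel {b = b} {b₂} da sa da₂ sa₂ len db sb db₂ sb₂ eq with last-peak⁺ da sa | last-peak⁺ da₂ sa₂
  ... | lastPeak y j refl | lastPeak y₂ j₂ refl
    with graft-cancel y y₂ db sb db₂ sb₂ (subst (Dyck m) (star-lastPeak y j b) (star-Dyck da sa db))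
           (+-cancelˡ-≡ (suc m) _ _ (trans (sym (lastPeak-length y j)) (trans len (lastPeak-length y₂ j₂))))
           (trans (sym (star-lastPeak y j b)) (trans eq (star-lastPeak y₂ j₂ b₂)))
  ...   | refl , refl , refl = refl , refl

  factorisation-unique : ∀ gs hs → All (IsGen m) gs → All (IsGen m) hs → prod m gs ≡ prod m hs → gs ≡ hs
  factorisation-unique []       []       _               _               _  = refl
  factorisation-unique []       (_ ∷ hs) _               ((hl , _) ∷ hgens) eq =
    ⊥-elim (peak-not-gen-star hl (proj₂ (prod-interval hs hgens)) (cong proj₁ eq))
  factorisation-unique (_ ∷ gs) []       ((gl , _) ∷ ggens) _               eq =
    ⊥-elim (peak-not-gen-star gl (proj₂ (prod-interval gs ggens)) (cong proj₁ (sym eq)))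
  factorisation-unique ((g , g′) ∷ gs) ((h , h′) ∷ hs) ((gl , _ , g≤g′) ∷ ggens) ((hl , _ , h≤h′) ∷ hgens) eq
    with prod-interval gs ggens | prod-interval hs hgens
  ... | (dV , _ , V≤W) , sV | (dV₂ , _ , V₂≤W₂) , sV₂
    with gen-star-injective gl hl (walk⇒path dV) sV (walk⇒path dV₂) sV₂ (cong proj₁ eq)
  ... | refl , eV
    with ≤-Dyck⁺ (gen-Dyck gl) (gen-size gl) g≤g′ | ≤-Dyck⁺ (gen-Dyck gl) (gen-size gl) h≤h′
       | ≤-Dyck⁺ (walk⇒path dV) sV V≤W | ≤-Dyck⁺ (walk⇒path dV₂) sV₂ V₂≤W₂
  ... | dg′ , sg′ | dh′ , sh′ | dW , sW | dW₂ , sW₂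
    with star-cancel dg′ sg′ dh′ sh′ (trans (sym (≤-length (gen-Dyck gl) g≤g′)) (≤-length (gen-Dyck gl) h≤h′))
                     dW sW dW₂ sW₂ (cong proj₂ eq)
  ... | refl , eW = cong ((g , g′) ∷_) (factorisation-unique gs hs ggens hgens (cong₂ _,_ eV eW))

proposition2p5 : (m : ℕ) → 1 ≤ m →
    -- the product of two intervals of positive size is again one
    (∀ v₁ w₁ v₂ w₂ → Interval⁺ m v₁ w₁ → Interval⁺ m v₂ w₂ →
       Interval⁺ m (star m v₁ v₂) (star m w₁ w₂))
    -- the unit lies in 𝓘_m and is a two-sided unit
  × Interval⁺ m (peak m) (peak m)
  × (∀ v w → Interval⁺ m v w →
       (unit m ⊛[ m ] (v , w) ≡ (v , w)) × ((v , w) ⊛[ m ] unit m ≡ (v , w)))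
    -- associativity
  × (∀ v₁ w₁ v₂ w₂ v₃ w₃ → Interval⁺ m v₁ w₁ → Interval⁺ m v₂ w₂ → Interval⁺ m v₃ w₃ →
       ((v₁ , w₁) ⊛[ m ] (v₂ , w₂)) ⊛[ m ] (v₃ , w₃)
         ≡ (v₁ , w₁) ⊛[ m ] ((v₂ , w₂) ⊛[ m ] (v₃ , w₃)))
    -- generators lie in 𝓘_m
  × (∀ v w → IsGen m (v , w) → Interval⁺ m v w)
    -- freeness: every element is a product of generators ...
  × (∀ v w → Interval⁺ m v w →
       ∃[ gs ] (All (IsGen m) gs × prod m gs ≡ (v , w)))
    -- ... in a unique way
  × (∀ gs hs → All (IsGen m) gs → All (IsGen m) hs →
       prod m gs ≡ prod m hs → gs ≡ hs)
proposition2p5 m _ =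
    (λ _ _ _ _ → interval-star)
  , unit-interval
  , (λ v w I → cong₂ _,_ (star-identityˡ {m} v) (star-identityˡ {m} w)
             , cong₂ _,_ (uncurry star-identityʳ (lower I)) (uncurry star-identityʳ (upper I)))
  , (λ _ _ _ _ v₃ w₃ I₁ I₂ _ → cong₂ _,_ (assoc v₃ (lower I₁) (lower I₂)) (assoc w₃ (upper I₁) (upper I₂)))
  , (λ _ _ → gen-interval)
  , (λ v _ I → factorisation (size v) ≤-refl I)
  , factorisation-unique
  where
    lower : ∀ {v w} → Interval⁺ m v w → Dyck m v × 1 ≤ size v
    lower ((dv , _ , _) , sv) = walk⇒path dv , sv

    upper : ∀ {v w} → Interval⁺ m v w → Dyck m w × 1 ≤ size w
    upper I@((_ , _ , v≤w) , _) = uncurry ≤-Dyck⁺ (lower I) v≤w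

    assoc : ∀ {a b} c → Dyck m a × 1 ≤ size a → Dyck m b × 1 ≤ size b → star m (star m a b) c ≡ star m a (star m b c)
    assoc c (da , sa) (db , sb) = star-assoc c da sa db sb
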